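{- The finite projective plane $\Psi$ of order $9$ (the Hughes plane of order $9$) is not a Poncelet plane.
   Context: $\Psi$ denotes the Hughes plane of order $9$, the self-dual non-Desarguesian projective plane of order $9$ constructed over the miniquaternion near-field; up to isomorphism it is the unique self-dual projective plane of order $9$ not isomorphic to $PG(2,9)$. An oval in a plane of order $n$ is a set of $n+1$ points no three collinear; secants/tangents of an oval are lines meeting it in two/exactly one point. For an ordered pair of ovals $(O_t,O_s)$, an $m$-sided Poncelet polygon ($3\le m\le n+1$) is a cyclically ordered $m$-tuple of distinct points of $O_s$ with every line joining cyclically consecutive vertices a tangent of $O_t$. $(O_t,O_s)$ is a Poncelet $m$-pair if an $m$-sided Poncelet polygon exists but no $m'$-sided one for $m'\neq m$, $3\le m'\le n+1$; a Poncelet $0$-pair if no secant of $O_s$ is a tangent of $O_t$; a Poncelet $\infty$-pair if some secant of $O_s$ is tangent to $O_t$ but no Poncelet polygon exists. A Poncelet plane is one in which every pair of ovals is a Poncelet $m$-pair ($3\le m\le n+1$), a Poncelet $0$-pair or a Poncelet $\infty$-pair. -}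

module Defs where

open import Data.Nat using (ℕ; zero; suc; _≤_)
open import Data.Fin using (Fin; toℕ) renaming (zero to fz; suc to fs)
open import Data.Bool using (Bool; true; false; _∧_; _∨_; not; if_then_else_; T)
open import Data.List using (List; []; _∷_)
open import Data.Bool.ListAction using (any)
open import Data.Product using (Σ; ∃; ∃₂; _×_; _,_)
open import Data.Sum using (_⊎_)
open import Relation.Nullary using (¬_)
open import Relation.Binary.PropositionalEquality using (_≡_; _≢_; refl)
open import Function.Definitions using (Injective)

module PlaneNotions {Point Line : Set} (_I_ : Point → Line → Set) (n : ℕ) where

  Collinear : Point → Point → Point → Set
  Collinear p q r = ∃ λ l → p I l × q I l × r I l

  Oval : Set
  Oval = Fin (suc n) → Point

  IsOval : Oval → Set
  IsOval O = Injective _≡_ _≡_ O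
           × (∀ i j k → i ≢ j → j ≢ k → i ≢ k → ¬ Collinear (O i) (O j) (O k))

  _∈O_ : Point → Oval → Set
  p ∈O O = ∃ λ j → O j ≡ p

  Tangent : Oval → Line → Set
  Tangent O l = ∃ λ p → p ∈O O × p I l × (∀ q → q ∈O O → q I l → q ≡ p)

  Secant : Oval → Line → Set
  Secant O l = ∃₂ λ p q → p ≢ q × p ∈O O × q ∈O O × p I l × q I l
             × (∀ r → r ∈O O → r I l → r ≡ p ⊎ r ≡ q)

  CycSucc : (m : ℕ) → Fin m → Fin m → Set
  CycSucc m i j = (suc (toℕ i) ≡ toℕ j) ⊎ (suc (toℕ i) ≡ m × toℕ j ≡ 0)

  PonceletPolygon : Oval → Oval → ℕ → Set
  PonceletPolygon Ot Os m =
    Σ (Fin m → Point) λ f →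
        Injective _≡_ _≡_ f
      × (∀ i → f i ∈O Os)
      × (∀ i j → CycSucc m i j → ∃ λ l → f i I l × f j I l × Tangent Ot l)

  InRange : ℕ → Set
  InRange m = 3 ≤ m × m ≤ suc n

  PonceletMPair : Oval → Oval → ℕ → Set
  PonceletMPair Ot Os m =
      InRange m
    × PonceletPolygon Ot Os m
    × (∀ m′ → InRange m′ → m′ ≢ m → ¬ PonceletPolygon Ot Os m′)

  Poncelet0Pair : Oval → Oval → Set
  Poncelet0Pair Ot Os = ∀ l → Secant Os l → ¬ Tangent Ot l

  PonceletInfPair : Oval → Oval → Set
  PonceletInfPair Ot Os =
      (∃ λ l → Secant Os l × Tangent Ot l)
    × (∀ m → InRange m → ¬ PonceletPolygon Ot Os m)

  PonceletPlane : Set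
  PonceletPlane =
    ∀ Ot Os → IsOval Ot → IsOval Os →
      (∃ λ m → PonceletMPair Ot Os m) ⊎ Poncelet0Pair Ot Os ⊎ PonceletInfPair Ot Os

data F3 : Set where
  f0 f1 f2 : F3

_+₃_ : F3 → F3 → F3
f0 +₃ y = y
f1 +₃ f0 = f1
f1 +₃ f1 = f2
f1 +₃ f2 = f0
f2 +₃ f0 = f2
f2 +₃ f1 = f0
f2 +₃ f2 = f1

_*₃_ : F3 → F3 → F3
f0 *₃ y = f0
f1 *₃ y = y
f2 *₃ f0 = f0
f2 *₃ f1 = f2
f2 *₃ f2 = f1

-₃_ : F3 → F3
-₃ f0 = f0
-₃ f1 = f2
-₃ f2 = f1

_==₃_ : F3 → F3 → Bool
f0 ==₃ f0 = true
f1 ==₃ f1 = true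
f2 ==₃ f2 = true
_ ==₃ _ = false

-- GF(9) = GF(3)[i] with i² = -1 ; the element  a + b i  is  gf a b
record GF9 : Set where
  constructor gf
  field re im : F3
open GF9

_+₉_ : GF9 → GF9 → GF9
gf a b +₉ gf c d = gf (a +₃ c) (b +₃ d)

_·₉_ : GF9 → GF9 → GF9
gf a b ·₉ gf c d = gf ((a *₃ c) +₃ (-₃ (b *₃ d))) ((a *₃ d) +₃ (b *₃ c))

_==₉_ : GF9 → GF9 → Bool
gf a b ==₉ gf c d = (a ==₃ c) ∧ (b ==₃ d)

zero₉ one₉ : GF9
zero₉ = gf f0 f0
one₉  = gf f1 f0

gf9Elems : List GF9
gf9Elems = gf f0 f0 ∷ gf f0 f1 ∷ gf f0 f2 ∷ gf f1 f0 ∷ gf f1 f1 ∷ gf f1 f2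
         ∷ gf f2 f0 ∷ gf f2 f1 ∷ gf f2 f2 ∷ []

isSquare : GF9 → Bool
isSquare b = any (λ x → (x ·₉ x) ==₉ b) gf9Elems

-- The miniquaternion (regular, Dickson) near-field N of order 9 on the
-- additive group of GF(9):   a ∘ b = a b   if b is a square,
--                            a ∘ b = a³ b  otherwise.
-- It is associative and right distributive, (a + b) ∘ c = a ∘ c + b ∘ c;
-- its kernel is K = GF(3) = { gf x f0 }.
N : Set
N = GF9

_∘_ : N → N → N
a ∘ b = if isSquare b then a ·₉ b else ((a ·₉ a) ·₉ a) ·₉ b

inKernel : N → Bool
inKernel (gf _ f0) = true
inKernel (gf _ _)  = false

-- Points: nonzero vectors (x , y , z) ∈ N³ modulo right multiplication
-- by nonzero scalars; canonical representatives (x,y,1), (x,1,0), (1,0,0).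
data Point : Set where
  aff : N → N → Point
  inf : N → Point
  ∞pt : Point

record Vec3 : Set where
  constructor v3
  field c₀ c₁ c₂ : N

coords : Point → Vec3
coords (aff x y) = v3 x y one₉
coords (inf x)   = v3 x one₉ zero₉
coords ∞pt       = v3 one₉ zero₉ zero₉

Mat3 : Set
Mat3 = Fin 3 → Fin 3 → F3

emb : F3 → N
emb x = gf x f0

row : Vec3 → Fin 3 → N
row (v3 a b c) fz = a
row (v3 a b c) (fs fz) = b
row (v3 a b c) (fs (fs fz)) = c

_⋆_ : Vec3 → Mat3 → Vec3
v ⋆ M = v3 (col fz) (col (fs fz)) (col (fs (fs fz)))
  where
    col : Fin 3 → N
    col j = ((row v fz ∘ emb (M fz j)) +₉ (row v (fs fz) ∘ emb (M (fs fz) j)))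
            +₉ (row v (fs (fs fz)) ∘ emb (M (fs (fs fz)) j))

-- A : companion matrix of the primitive polynomial x³ - x - 1 over GF(3);
-- it induces a collineation of order q² + q + 1 = 13 on points.
matA : Mat3
matA fz fz = f0
matA fz (fs fz) = f1
matA fz (fs (fs fz)) = f0
matA (fs fz) fz = f0
matA (fs fz) (fs fz) = f0
matA (fs fz) (fs (fs fz)) = f1
matA (fs (fs fz)) fz = f1
matA (fs (fs fz)) (fs fz) = f1
matA (fs (fs fz)) (fs (fs fz)) = f0

-- B = A⁻¹
matB : Mat3
matB fz fz = f2
matB fz (fs fz) = f0
matB fz (fs (fs fz)) = f1
matB (fs fz) fz = f1
matB (fs fz) (fs fz) = f0
matB (fs fz) (fs (fs fz)) = f0
matB (fs (fs fz)) fz = f0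
matB (fs (fs fz)) (fs fz) = f1
matB (fs (fs fz)) (fs (fs fz)) = f0

powB : ℕ → Vec3 → Vec3
powB zero v = v
powB (suc k) v = powB k v ⋆ matB

-- Lines: L(a)·A^i for a ∈ {1} ∪ (N ∖ K) and i = 0 … 12, where
-- L(a) = { (x , y , z) : x + a ∘ y + z = 0 }.
isLineParam : N → Bool
isLineParam a = (a ==₉ one₉) ∨ not (inKernel a)

record Line : Set where
  constructor mkLine
  field
    param : N
    ok    : T (isLineParam param)
    idx   : Fin 13

onL : N → Vec3 → Bool
onL a (v3 x y z) = ((x +₉ (a ∘ y)) +₉ z) ==₉ zero₉

-- P ∈ L(a)·A^i  ⇔  P·A^{-i} ∈ L(a)
_I_ : Point → Line → Set
p I mkLine a _ i = T (onL a (powB (toℕ i) (coords p)))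

module Ψ = PlaneNotions _I_ 9

-- If an ordered pair of ovals admits Poncelet polygons of two different sizes,
-- it is neither a Poncelet m-pair nor an ∞-pair, and it is not a 0-pair either,
-- since a side of a polygon is a secant of the outer oval touching the inner one.
-- In Ψ there are two ovals admitting both a Poncelet triangle and a Poncelet
-- quadrilateral; that they are ovals and that the polygon sides are tangents is
-- verified by exhaustive search over the 91 lines.
module Submission where

open import Defs hiding (_∘_)
open import Relation.Nullary using (¬_)
open import Data.Nat as ℕ using (ℕ; zero; suc; _≤_; _≤?_; z≤n; s≤s)
open import Data.Nat.Properties using (+-suc; ≤-trans)
open import Data.Fin as Fin using (Fin; toℕ; punchIn; punchOut; #_)
open import Data.Fin.Properties using (all?; any?; punchIn-punchOut; punchOut-injective)
open import Data.Bool using (Bool; true; false; T; if_then_else_)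
open import Data.Unit using (tt)
open import Data.Empty using (⊥-elim)
open import Data.Vec using (_∷_; []; lookup)
open import Data.Product using (∃; _×_; _,_; proj₁)
open import Data.Sum using (_⊎_; inj₁; inj₂)
open import Function.Definitions using (Injective)
open import Relation.Binary.Definitions using (Decidable; DecidableEquality)
open import Relation.Binary.PropositionalEquality
  using (_≡_; _≢_; refl; sym; trans; cong; cong₂; subst; module ≡-Reasoning)
open import Relation.Nullary.Decidable
  using (Dec; yes; no; does; map′; from-yes; dec-true; _×-dec_; _⊎-dec_; _→-dec_; T?)

count : ∀ {n} → (Fin n → Bool) → ℕ
count {zero}  f = 0
count {suc n} f = (if f Fin.zero then 1 else 0) ℕ.+ count (λ j → f (Fin.suc j))

count-punchIn : ∀ {n} (f : Fin (suc n) → Bool) i → f i ≡ true →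
                count f ≡ suc (count (λ j → f (punchIn i j)))
count-punchIn f Fin.zero fi = cong (λ b → (if b then 1 else 0) ℕ.+ count (λ j → f (Fin.suc j))) fi
count-punchIn {suc n} f (Fin.suc i) fi = begin
  (if f Fin.zero then 1 else 0) ℕ.+ count (λ j → f (Fin.suc j))
    ≡⟨ cong ((if f Fin.zero then 1 else 0) ℕ.+_) (count-punchIn (λ j → f (Fin.suc j)) i fi) ⟩
  (if f Fin.zero then 1 else 0) ℕ.+ suc (count (λ j → f (Fin.suc (punchIn i j))))
    ≡⟨ +-suc _ _ ⟩
  suc (count (λ j → f (punchIn (Fin.suc i) j)))  ∎
  where open ≡-Reasoning

1≤count : ∀ {n} (f : Fin n → Bool) {i} → f i ≡ true → 1 ≤ count f
1≤count {suc n} f {i} fi = subst (1 ≤_) (sym (count-punchIn f i fi)) (s≤s z≤n)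

true-at-punchOut : ∀ {n} (f : Fin (suc n) → Bool) {i j} (i≢j : i ≢ j) →
                   f j ≡ true → f (punchIn i (punchOut i≢j)) ≡ true
true-at-punchOut f i≢j fj = trans (cong f (punchIn-punchOut i≢j)) fj

2≤count : ∀ {n} (f : Fin n → Bool) {i j} → i ≢ j →
          f i ≡ true → f j ≡ true → 2 ≤ count f
2≤count {suc n} f {i} i≢j fi fj =
  subst (2 ≤_) (sym (count-punchIn f i fi))
    (s≤s (1≤count (λ j → f (punchIn i j)) (true-at-punchOut f i≢j fj)))

3≤count : ∀ {n} (f : Fin n → Bool) {i j k} → i ≢ j → i ≢ k → j ≢ k →
          f i ≡ true → f j ≡ true → f k ≡ true → 3 ≤ count f
3≤count {suc n} f {i} i≢j i≢k j≢k fi fj fk =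
  subst (3 ≤_) (sym (count-punchIn f i fi))
    (s≤s (2≤count (λ j → f (punchIn i j))
            (λ e → j≢k (punchOut-injective i≢j i≢k e))
            (true-at-punchOut f i≢j fj) (true-at-punchOut f i≢k fk)))

injective? : ∀ {m} {B : Set} → DecidableEquality B → (f : Fin m → B) →
             Dec (Injective _≡_ _≡_ f)
injective? _≟_ f = map′ (λ h {i} {j} → h i j) (λ h i j → h)
  (all? λ i → all? λ j → (f i ≟ f j) →-dec (i Fin.≟ j))

module PonceletFacts {Point Line : Set} (_I_ : Point → Line → Set) (n : ℕ) where

  open PlaneNotions _I_ n

  polygon-side-secant-tangent : ∀ {Ot Os m} → IsOval Os → PonceletPolygon Ot Os (suc (suc m)) →
                                ∃ λ l → Secant Os l × Tangent Ot l
  polygon-side-secant-tangent {Os = Os} (_ , noThree) (v , v-inj , v∈Os , sides)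
    with sides Fin.zero (Fin.suc Fin.zero) (inj₁ refl)
       | v∈Os Fin.zero | v∈Os (Fin.suc Fin.zero)
  ... | l , p∈l , q∈l , tangent | a , a↦p | b , b↦q =
    l , (p , q , p≢q , v∈Os Fin.zero , v∈Os (Fin.suc Fin.zero) , p∈l , q∈l , onlyTwo) , tangent
    where
    p = v Fin.zero
    q = v (Fin.suc Fin.zero)
    p≢q : p ≢ q
    p≢q e with v-inj e
    ... | ()
    onlyTwo : ∀ r → r ∈O Os → r I l → r ≡ p ⊎ r ≡ q
    onlyTwo r (c , refl) r∈l with c Fin.≟ a | c Fin.≟ b
    ... | yes refl | _        = inj₁ a↦p
    ... | no _     | yes refl = inj₂ b↦q
    ... | no c≢a   | no c≢b   =
      ⊥-elim (noThree a b c (λ { refl → p≢q (trans (sym a↦p) b↦q) })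
                (λ e → c≢b (sym e)) (λ e → c≢a (sym e))
                (l , subst (_I l) (sym a↦p) p∈l , subst (_I l) (sym b↦q) q∈l , r∈l))

  two-polygons⇒unclassified :
    ∀ {Ot Os m₁ m₂} → IsOval Os → InRange m₁ → InRange m₂ → m₁ ≢ m₂ →
    PonceletPolygon Ot Os m₁ → PonceletPolygon Ot Os m₂ →
    ¬ ((∃ λ m → PonceletMPair Ot Os m) ⊎ Poncelet0Pair Ot Os ⊎ PonceletInfPair Ot Os)
  two-polygons⇒unclassified {m₁ = m₁} _ r₁ r₂ m₁≢m₂ P₁ P₂ (inj₁ (m , _ , _ , onlyM))
    with m₁ ℕ.≟ m
  ... | yes refl = onlyM _ r₂ (λ e → m₁≢m₂ (sym e)) P₂
  ... | no m₁≢m  = onlyM _ r₁ m₁≢m P₁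
  two-polygons⇒unclassified Os-oval (s≤s (s≤s (s≤s _)) , _) _ _ P₁ _ (inj₂ (inj₁ noSecantTangent))
    with polygon-side-secant-tangent Os-oval P₁
  ... | l , secant , tangent = noSecantTangent l secant tangent
  two-polygons⇒unclassified _ r₁ _ _ P₁ _ (inj₂ (inj₂ (_ , noPolygon))) = noPolygon _ r₁ P₁

  two-polygons⇒¬PonceletPlane :
    ∀ {Ot Os m₁ m₂} → IsOval Ot → IsOval Os → InRange m₁ → InRange m₂ → m₁ ≢ m₂ →
    PonceletPolygon Ot Os m₁ → PonceletPolygon Ot Os m₂ → ¬ PonceletPlane
  two-polygons⇒¬PonceletPlane Ot-oval Os-oval r₁ r₂ m₁≢m₂ P₁ P₂ poncelet =
    two-polygons⇒unclassified Os-oval r₁ r₂ m₁≢m₂ P₁ P₂ (poncelet _ _ Ot-oval Os-oval)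

  module WithDecidableIncidence (_I?_ : Decidable _I_) where

    AtMostTwoOnEachLine : Oval → Set
    AtMostTwoOnEachLine O = ∀ l → count (λ j → does (O j I? l)) ≤ 2

    isOval : ∀ {O} → Injective _≡_ _≡_ O → AtMostTwoOnEachLine O → IsOval O
    isOval {O} O-inj atMostTwo = O-inj , noThree
      where
      noThree : ∀ i j k → i ≢ j → j ≢ k → i ≢ k → ¬ Collinear (O i) (O j) (O k)
      noThree i j k i≢j j≢k i≢k (l , i∈l , j∈l , k∈l) =
        3≰2 (≤-trans (3≤count (λ j → does (O j I? l)) i≢j i≢k j≢k
                        (dec-true (O i I? l) i∈l) (dec-true (O j I? l) j∈l)
                        (dec-true (O k I? l) k∈l))
                     (atMostTwo l))
        where
        3≰2 : ¬ 3 ≤ 2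
        3≰2 (s≤s (s≤s ()))

    -- Uniqueness is stated on indices, so that it is decidable without comparing points.
    TangentAt : Oval → Line → Fin (suc n) → Set
    TangentAt O l t = O t I l × (∀ j → O j I l → j ≡ t)

    tangentAt? : ∀ O l → Dec (∃ (TangentAt O l))
    tangentAt? O l = any? λ t → (O t I? l) ×-dec all? λ j → (O j I? l) →-dec (j Fin.≟ t)

    tangentAt⇒tangent : ∀ {O l t} → TangentAt O l t → Tangent O l
    tangentAt⇒tangent {O} {t = t} (t∈l , onlyT) =
      O t , (t , refl) , t∈l , λ { q (j , refl) q∈l → cong O (onlyT j q∈l) }

    TouchingSides : ∀ {m} → Oval → Oval → (Fin m → Fin (suc n)) → Set
    TouchingSides {m} Ot Os v = ∀ i j → CycSucc m i j →
      ∃ λ l → Os (v i) I l × Os (v j) I l × ∃ (TangentAt Ot l)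

    inscribed-polygon : ∀ {Ot Os m} (v : Fin m → Fin (suc n)) → Injective _≡_ _≡_ Os →
                        Injective _≡_ _≡_ v → TouchingSides Ot Os v → PonceletPolygon Ot Os m
    inscribed-polygon {Os = Os} v Os-inj v-inj touching =
      (λ i → Os (v i)) , (λ e → v-inj (Os-inj e)) , (λ i → v i , refl) , sides
      where
      sides = λ i j i↦j → let l , i∈l , j∈l , _ , tangentAt = touching i j i↦j
                           in l , i∈l , j∈l , tangentAt⇒tangent tangentAt

_≟₃_ : DecidableEquality F3
f0 ≟₃ f0 = yes refl
f1 ≟₃ f1 = yes refl
f2 ≟₃ f2 = yes refl
f0 ≟₃ f1 = no λ ()
f0 ≟₃ f2 = no λ ()
f1 ≟₃ f0 = no λ ()
f1 ≟₃ f2 = no λ ()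
f2 ≟₃ f0 = no λ ()
f2 ≟₃ f1 = no λ ()

_≟₉_ : DecidableEquality GF9
gf a b ≟₉ gf c d =
  map′ (λ (a≡c , b≡d) → cong₂ gf a≡c b≡d) (λ { refl → refl , refl }) ((a ≟₃ c) ×-dec (b ≟₃ d))

_≟ₚ_ : DecidableEquality Point
aff x y ≟ₚ aff x′ y′ =
  map′ (λ (x≡x′ , y≡y′) → cong₂ aff x≡x′ y≡y′) (λ { refl → refl , refl }) ((x ≟₉ x′) ×-dec (y ≟₉ y′))
inf x ≟ₚ inf x′ = map′ (cong inf) (λ { refl → refl }) (x ≟₉ x′)
∞pt ≟ₚ ∞pt = yes refl
aff _ _ ≟ₚ inf _   = no λ ()
aff _ _ ≟ₚ ∞pt     = no λ ()
inf _   ≟ₚ aff _ _ = no λ ()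
inf _   ≟ₚ ∞pt     = no λ ()
∞pt     ≟ₚ aff _ _ = no λ ()
∞pt     ≟ₚ inf _   = no λ ()

_I?_ : Decidable _I_
p I? mkLine a _ i = T? (onL a (powB (toℕ i) (coords p)))

all-F3? : {P : F3 → Set} → (∀ x → Dec (P x)) → Dec (∀ x → P x)
all-F3? P? = map′ (λ (p₀ , p₁ , p₂) → λ { f0 → p₀ ; f1 → p₁ ; f2 → p₂ }) (λ h → h f0 , h f1 , h f2)
  (P? f0 ×-dec P? f1 ×-dec P? f2)

any-F3? : {P : F3 → Set} → (∀ x → Dec (P x)) → Dec (∃ P)
any-F3? P? =
  map′ (λ { (inj₁ p) → f0 , p ; (inj₂ (inj₁ p)) → f1 , p ; (inj₂ (inj₂ p)) → f2 , p })
       (λ { (f0 , p) → inj₁ p ; (f1 , p) → inj₂ (inj₁ p) ; (f2 , p) → inj₂ (inj₂ p) })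
       (P? f0 ⊎-dec P? f1 ⊎-dec P? f2)

all-GF9? : {P : GF9 → Set} → (∀ x → Dec (P x)) → Dec (∀ x → P x)
all-GF9? P? = map′ (λ h x → h (GF9.re x) (GF9.im x)) (λ h a b → h (gf a b))
  (all-F3? λ a → all-F3? λ b → P? (gf a b))

any-GF9? : {P : GF9 → Set} → (∀ x → Dec (P x)) → Dec (∃ P)
any-GF9? P? = map′ (λ (a , b , p) → gf a b , p) (λ (gf a b , p) → a , b , p)
  (any-F3? λ a → any-F3? λ b → P? (gf a b))

all-T? : ∀ b {P : T b → Set} → (∀ t → Dec (P t)) → Dec (∀ t → P t)
all-T? true  P? = map′ (λ p _ → p) (λ h → h tt) (P? tt)
all-T? false P? = yes λ ()

any-T? : ∀ b {P : T b → Set} → (∀ t → Dec (P t)) → Dec (∃ P)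
any-T? true  P? = map′ (tt ,_) (λ (_ , p) → p) (P? tt)
any-T? false P? = no λ { (() , _) }

all-Line? : {P : Line → Set} → (∀ l → Dec (P l)) → Dec (∀ l → P l)
all-Line? P? = map′ (λ h (mkLine a ok i) → h a ok i) (λ h a ok i → h (mkLine a ok i))
  (all-GF9? λ a → all-T? (isLineParam a) λ ok → all? λ i → P? (mkLine a ok i))

any-Line? : {P : Line → Set} → (∀ l → Dec (P l)) → Dec (∃ P)
any-Line? P? = map′ (λ (a , ok , i , p) → mkLine a ok i , p) (λ (mkLine a ok i , p) → a , ok , i , p)
  (any-GF9? λ a → any-T? (isLineParam a) λ ok → any? λ i → P? (mkLine a ok i))

open PonceletFacts _I_ 9
open WithDecidableIncidence _I?_
open Ψ using (Oval; IsOval; InRange; CycSucc; PonceletPolygon)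

atMostTwoOnEachLine? : ∀ O → Dec (AtMostTwoOnEachLine O)
atMostTwoOnEachLine? O = all-Line? λ l → count (λ j → does (O j I? l)) ≤? 2

inRange? : ∀ m → Dec (InRange m)
inRange? m = (3 ≤? m) ×-dec (m ≤? 10)

cycSucc? : ∀ m i j → Dec (CycSucc m i j)
cycSucc? m i j = (suc (toℕ i) ℕ.≟ toℕ j) ⊎-dec ((suc (toℕ i) ℕ.≟ m) ×-dec (toℕ j ℕ.≟ 0))

touchingSides? : ∀ {m} Ot Os (v : Fin m → Fin 10) → Dec (TouchingSides Ot Os v)
touchingSides? Ot Os v = all? λ i → all? λ j → cycSucc? _ i j →-dec
  any-Line? λ l → (Os (v i) I? l) ×-dec (Os (v j) I? l) ×-dec tangentAt? Ot l

inner outer : Oval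
inner = lookup
  ( aff (gf f0 f1) (gf f2 f1) ∷ aff (gf f1 f0) (gf f1 f0) ∷ aff (gf f2 f2) (gf f0 f0)
  ∷ inf (gf f0 f0)            ∷ aff (gf f1 f1) (gf f2 f2) ∷ aff (gf f2 f0) (gf f2 f0)
  ∷ aff (gf f0 f0) (gf f1 f0) ∷ aff (gf f1 f2) (gf f2 f1) ∷ aff (gf f2 f1) (gf f0 f0)
  ∷ aff (gf f0 f2) (gf f2 f2) ∷ [])
outer = lookup
  ( aff (gf f2 f1) (gf f1 f0) ∷ inf (gf f0 f2)            ∷ aff (gf f0 f1) (gf f1 f2)
  ∷ aff (gf f0 f2) (gf f1 f1) ∷ inf (gf f2 f1)            ∷ aff (gf f2 f1) (gf f0 f1)
  ∷ aff (gf f0 f0) (gf f1 f2) ∷ aff (gf f1 f2) (gf f1 f0) ∷ aff (gf f0 f0) (gf f1 f1)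
  ∷ aff (gf f1 f2) (gf f2 f2) ∷ [])

triangle : Fin 3 → Fin 10
triangle = lookup (# 5 ∷ # 6 ∷ # 9 ∷ [])

quadrilateral : Fin 4 → Fin 10
quadrilateral = lookup (# 0 ∷ # 4 ∷ # 1 ∷ # 8 ∷ [])

inner-oval : IsOval inner
inner-oval = isOval (from-yes (injective? _≟ₚ_ inner)) (from-yes (atMostTwoOnEachLine? inner))

outer-oval : IsOval outer
outer-oval = isOval (from-yes (injective? _≟ₚ_ outer)) (from-yes (atMostTwoOnEachLine? outer))

triangle-polygon : PonceletPolygon inner outer 3
triangle-polygon = inscribed-polygon triangle (proj₁ outer-oval)
  (from-yes (injective? Fin._≟_ triangle)) (from-yes (touchingSides? inner outer triangle))

quadrilateral-polygon : PonceletPolygon inner outer 4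
quadrilateral-polygon = inscribed-polygon quadrilateral (proj₁ outer-oval)
  (from-yes (injective? Fin._≟_ quadrilateral)) (from-yes (touchingSides? inner outer quadrilateral))

theorem12 : ¬ Ψ.PonceletPlane
theorem12 = two-polygons⇒¬PonceletPlane inner-oval outer-oval
  (from-yes (inRange? 3)) (from-yes (inRange? 4)) (λ ()) triangle-polygon quadrilateral-polygon
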